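{- Let $G$ be a graph with vertex set $V$, let $W\subseteq V$ be reducible in $G$, and let $W_1,W_2\subseteq V\setminus W$. Then $$\mathrm{rank}_{\Gamma_W(G)}(W_1,W_2)=\mathrm{rank}_G(W\cup W_1,\,W\cup W_2)-\mathrm{rank}_G(W).$$
   Context: A graph is a finite graph with vertex set $V$, no multiple edges, in which each vertex may or may not carry a loop. Its adjacency matrix $A$ is the symmetric $V\times V$ matrix over $\mathbf{F}_2$ with $A_{vw}=1$ iff $v\ne w$ are adjacent and $A_{vv}=1$ iff $v$ has a loop. For a graph $H$ and vertex subsets $U_1,U_2$, $\mathrm{rank}_H(U_1,U_2)$ is the $\mathbf{F}_2$-rank of the submatrix of the adjacency matrix of $H$ with rows $U_1$ and columns $U_2$, and $\mathrm{rank}_H(U)=\mathrm{rank}_H(U,U)$. Let $\mathcal{V}$ be the $\mathbf{F}_2$-vector space with basis $V$, $\mathcal{E}(x,y)=x^TAy$, $\langle W\rangle$ the span of $W$, $\langle W\rangle^{\perp}=\{x:\mathcal{E}(x,w)=0\ \forall w\in\langle W\rangle\}$. $W$ is reducible in $G$ if $\langle W\rangle+\langle W\rangle^{\perp}=\mathcal{V}$. For reducible $W$, $\Gamma_W(G)$ is the graph on $V\setminus W$ in which $v,w\in V\setminus W$ (possibly $v=w$, concerning a loop) are adjacent iff $\mathcal{E}(v',w')=1$, where $v',w'\in\langle W\rangle^{\perp}$ are any vectors with $v-v',w-w'\in\langle W\rangle$ (independent of the choice). -}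

module Defs where

open import Data.Nat using (ℕ; zero; suc; _+_; _⊔_)
open import Data.Fin using (Fin; zero; suc)
open import Data.Bool using (Bool; true; false; _∧_; _∨_; _xor_; not; if_then_else_)
open import Data.List using (List; []; _∷_; concatMap; foldr; map)
open import Data.Product using (Σ; _×_; _,_)
open import Relation.Binary.PropositionalEquality using (_≡_)

-- Vertex set V = Fin n.  Vectors of 𝒱 = F₂^V and subsets of V are both
-- represented as Boolean functions  Fin n → Bool  (F₂ = Bool, + = xor).

Vec₂ : ℕ → Set
Vec₂ n = Fin n → Bool

Subset : ℕ → Set
Subset n = Fin n → Bool

Matrix : ℕ → Set
Matrix n = Fin n → Fin n → Bool

-- A graph (loops allowed, no multiple edges) on V = Fin n, given by its
-- adjacency matrix, which must be symmetric; the diagonal is arbitrary (loops).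
record Graph (n : ℕ) : Set where
  field
    adj : Matrix n
    sym : ∀ v w → adj v w ≡ adj w v
open Graph public

Σ₂ : ∀ {n} → (Fin n → Bool) → Bool
Σ₂ {zero}  f = false
Σ₂ {suc n} f = f zero xor Σ₂ (λ i → f (suc i))

card : ∀ {n} → Subset n → ℕ
card {zero}  S = 0
card {suc n} S = (if S zero then 1 else 0) + card (λ i → S (suc i))

all₂ : ∀ {n} → (Fin n → Bool) → Bool
all₂ {zero}  f = true
all₂ {suc n} f = f zero ∧ all₂ (λ i → f (suc i))

any₂ : ∀ {n} → (Fin n → Bool) → Bool
any₂ {zero}  f = false
any₂ {suc n} f = f zero ∨ any₂ (λ i → f (suc i))

_⊆ᵇ_ : ∀ {n} → Subset n → Subset n → Bool
S ⊆ᵇ T = all₂ (λ i → not (S i) ∨ T i)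

allSubsets : (n : ℕ) → List (Subset n)
allSubsets zero    = (λ ()) ∷ []
allSubsets (suc n) = concatMap (λ S → cons false S ∷ cons true S ∷ []) (allSubsets n)
  where
  cons : Bool → Subset n → Subset (suc n)
  cons b S zero    = b
  cons b S (suc i) = S i

-- The rows of M indexed by S ⊆ U₁, restricted to the columns U₂, are
-- linearly independent over F₂ iff no nonempty subfamily T ⊆ S sums to
-- zero, i.e. for every nonempty T ⊆ S there is a column j ∈ U₂ with
-- Σ_{i ∈ T} M i j = 1.
rowsIndependent : ∀ {n} → Matrix n → Subset n → Subset n → Bool
rowsIndependent {n} M U₂ S =
  foldr (λ T r → r ∧ (not (T ⊆ᵇ S ∧ any₂ T)
                      ∨ any₂ (λ j → U₂ j ∧ Σ₂ (λ i → T i ∧ M i j))))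
        true (allSubsets n)

rank : ∀ {n} → Matrix n → Subset n → Subset n → ℕ
rank {n} M U₁ U₂ =
  foldr (λ S r → if (S ⊆ᵇ U₁) ∧ rowsIndependent M U₂ S then card S ⊔ r else r)
        0 (allSubsets n)

rankG : ∀ {n} → Graph n → Subset n → Subset n → ℕ
rankG G = rank (adj G)

ℰ : ∀ {n} → Graph n → Vec₂ n → Vec₂ n → Bool
ℰ G x y = Σ₂ (λ i → Σ₂ (λ j → x i ∧ adj G i j ∧ y j))

_+ᵥ_ : ∀ {n} → Vec₂ n → Vec₂ n → Vec₂ n
(x +ᵥ y) i = x i xor y i

-- ⟨W⟩ : the span of the basis vectors v ∈ W, i.e. the vectors supported in W.
_∈⟨_⟩ : ∀ {n} → Vec₂ n → Subset n → Set
x ∈⟨ W ⟩ = ∀ i → x i ≡ true → W i ≡ true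

_∈⟨_⟩⊥[_] : ∀ {n} → Vec₂ n → Subset n → Graph n → Set
x ∈⟨ W ⟩⊥[ G ] = ∀ w → w ∈⟨ W ⟩ → ℰ G x w ≡ false

-- W is reducible in G iff ⟨W⟩ + ⟨W⟩^⊥ = 𝒱.
Reducible : ∀ {n} → Graph n → Subset n → Set
Reducible {n} G W = ∀ (z : Vec₂ n) → Σ (Vec₂ n) λ a → Σ (Vec₂ n) λ b →
  a ∈⟨ W ⟩ × b ∈⟨ W ⟩⊥[ G ] × (∀ i → z i ≡ (a +ᵥ b) i)

basis : ∀ {n} → Fin n → Vec₂ n
basis zero    zero    = true
basis zero    (suc j) = false
basis (suc i) zero    = false
basis (suc i) (suc j) = basis i j

-- A choice, for every vertex v ∉ W, of a vector v' ∈ ⟨W⟩^⊥ with v - v' ∈ ⟨W⟩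
-- (exactly the "any vectors v',w'" in the definition of Γ_W(G)).
record Representatives {n} (G : Graph n) (W : Subset n) : Set where
  field
    rep     : Fin n → Vec₂ n
    rep-⊥   : ∀ v → W v ≡ false → rep v ∈⟨ W ⟩⊥[ G ]
    rep-dif : ∀ v → W v ≡ false → (basis v +ᵥ rep v) ∈⟨ W ⟩
open Representatives public

-- Adjacency matrix of Γ_W(G).  Only its entries at pairs v,w ∈ V ∖ W are
-- meaningful (the graph Γ_W(G) lives on V ∖ W); it is only ever used through
-- rank(W₁,W₂) with W₁,W₂ ⊆ V ∖ W.
Γ : ∀ {n} (G : Graph n) (W : Subset n) → Representatives G W → Matrix n
Γ G W R v w = ℰ G (rep R v) (rep R w)

_∪_ : ∀ {n} → Subset n → Subset n → Subset n
(S ∪ T) i = S i ∨ T i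

_⊆∁_ : ∀ {n} → Subset n → Subset n → Set
S ⊆∁ W = ∀ i → S i ≡ true → W i ≡ false

module Submission where

-- Let B be a row basis (maximum independent set of rows) of A on (W,W) and C
-- one of the adjacency matrix of Γ_W(G) on (W₁,W₂).  Then K = B ∪ C is
--  (i)  independent in A on the columns W ∪ W₂: a dependency T ⊆ K splits into
--       a part in ⟨W⟩, orthogonal to all representatives w', and a part off W
--       whose Γ_W-combination is its ℰ-pairing with the representatives of W₂;
--       so the part off W is empty by independence of C, and then T ⊆ B
--       contradicts independence of B;
--  (ii) spanning, on the columns W ∪ W₂, for all rows of W ∪ W₁: rows of W are
--       spanned by B on every column, because a vector of ⟨W⟩ orthogonal to
--       all e_j (j ∈ W) is orthogonal to ⟨W⟩ + ⟨W⟩^⊥ = 𝒱; a row i ∈ W₁ spanned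
--       by C in Γ_W(G) gives T = F + e_i whose ⟨W⟩^⊥-part vanishes on W ∪ W₂
--       and whose ⟨W⟩-part is spanned by B.
-- Hence rank_G(W ∪ W₁, W ∪ W₂) = |B| + |C| = rank_G(W) + rank_{Γ_W(G)}(W₁,W₂).

open import Defs hiding (sym)
open import Data.Nat using (ℕ; zero; suc; _+_; _∸_; _^_; _≤_; _<_; _⊔_; z≤n; s≤s)
open import Data.Nat.Properties
  using (module ≤-Reasoning; m+n∸m≡n; ≤-antisym; +-suc; +-comm; +-identityʳ; n<1+n; ≮⇒≥; <⇒≱;
         ^-monoʳ-<; ≤-trans; ≤-reflexive; ≤-total; m≤m⊔n; m≤n⊔m; m≤n⇒m⊔n≡n; m≥n⇒m⊔n≡m)
open import Data.Fin using (Fin; zero; suc)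
open import Data.Bool using (Bool; true; false; not; _∧_; _∨_; _xor_; if_then_else_)
open import Data.Bool.Properties
  using (∨-zeroʳ; ∨-identityʳ; ∨-conicalˡ; ∨-conicalʳ; ∧-assoc; ∧-comm; ∧-zeroʳ; ∧-identityʳ;
         ∧-conicalˡ; ∧-conicalʳ; ∧-distribˡ-xor; ∧-distribʳ-xor; xor-identityʳ; xor-same; xor-comm;
         not-involutive; xor-∧-commutativeRing)
open import Data.Product using (Σ; _×_; _,_; proj₁; proj₂)
open import Data.Sum using (_⊎_; inj₁; inj₂; [_,_]′)
open import Data.Empty using (⊥; ⊥-elim)
open import Data.List using (List; []; _∷_; _++_; foldr; map; length)
open import Data.List.Properties using (length-map; length-++; length-removeAt′)
open import Data.List.Relation.Unary.AllPairs using (AllPairs; []; _∷_)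
import Data.List.Relation.Unary.AllPairs as AllPairs
import Data.List.Relation.Unary.All.Properties as Allₚ
import Data.List.Relation.Unary.AllPairs.Properties as AllPairsₚ
open import Data.Vec.Functional using (tail) renaming (_∷_ to _◂_)
open import Function using (_∘_)
open import Data.List.Relation.Unary.All as All using (All; []; _∷_)
open import Data.List.Relation.Unary.Any as Any using (Any; here; there)
import Data.List.Relation.Unary.Any.Properties as Anyₚ
open import Relation.Nullary using (¬_)
open import Algebra.Bundles using (CommutativeRing)
import Algebra.Properties.CommutativeSemigroup as CommutativeSemigroupProperties
open import Relation.Binary.PropositionalEquality

open CommutativeSemigroupProperties
  (CommutativeRing.+-commutativeSemigroup xor-∧-commutativeRing)
  using () renaming (interchange to xor-interchange)

true≢false : true ≡ false → ⊥
true≢false ()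

not-false : ∀ {b} → not b ≡ false → b ≡ true
not-false {true} _ = refl

∨-true : ∀ {a b} → a ∨ b ≡ true → a ≡ true ⊎ b ≡ true
∨-true {true}  _ = inj₁ refl
∨-true {false} e = inj₂ e

xor-true : ∀ {a b} → a xor b ≡ true → a ≡ true ⊎ b ≡ true
xor-true {true}  _ = inj₁ refl
xor-true {false} e = inj₂ e

xor-≡ : ∀ {a b} → a xor b ≡ false → a ≡ b
xor-≡ {false} {false} _ = refl
xor-≡ {true}  {true}  _ = refl

xor-cancelˡ : ∀ a b → a xor (a xor b) ≡ b
xor-cancelˡ false b = refl
xor-cancelˡ true  b = not-involutive b

xor-cancelʳ : ∀ a b → (a xor b) xor b ≡ a
xor-cancelʳ a b = trans (xor-comm (a xor b) b) (trans (cong (b xor_) (xor-comm a b)) (xor-cancelˡ b a))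

Σ₂-cong : ∀ {n} {f g : Fin n → Bool} → f ≗ g → Σ₂ f ≡ Σ₂ g
Σ₂-cong {zero}  e = refl
Σ₂-cong {suc n} e = cong₂ _xor_ (e zero) (Σ₂-cong (λ i → e (suc i)))

Σ₂-xor : ∀ {n} (f g : Fin n → Bool) → Σ₂ (λ i → f i xor g i) ≡ Σ₂ f xor Σ₂ g
Σ₂-xor {zero}  f g = refl
Σ₂-xor {suc n} f g =
  trans (cong ((f zero xor g zero) xor_) (Σ₂-xor (λ i → f (suc i)) (λ i → g (suc i))))
        (xor-interchange (f zero) (g zero) _ _)

Σ₂-zero : ∀ {n} {f : Fin n → Bool} → (∀ i → f i ≡ false) → Σ₂ f ≡ false
Σ₂-zero {zero}  e = refl
Σ₂-zero {suc n} e = cong₂ _xor_ (e zero) (Σ₂-zero (λ i → e (suc i)))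

Σ₂-∧ˡ : ∀ {n} b (f : Fin n → Bool) → Σ₂ (λ i → b ∧ f i) ≡ b ∧ Σ₂ f
Σ₂-∧ˡ {zero}  b f = sym (∧-comm b false)
Σ₂-∧ˡ {suc n} b f = trans (cong ((b ∧ f zero) xor_) (Σ₂-∧ˡ b (λ i → f (suc i))))
                          (sym (∧-distribˡ-xor b (f zero) _))

Σ₂-∧ʳ : ∀ {n} b (f : Fin n → Bool) → Σ₂ (λ i → f i ∧ b) ≡ Σ₂ f ∧ b
Σ₂-∧ʳ b f = trans (Σ₂-cong (λ i → ∧-comm (f i) b)) (trans (Σ₂-∧ˡ b f) (∧-comm b _))

Σ₂-swap : ∀ {m n} (f : Fin m → Fin n → Bool) →
          Σ₂ (λ i → Σ₂ (f i)) ≡ Σ₂ (λ j → Σ₂ (λ i → f i j))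
Σ₂-swap {zero} {n} f = sym (Σ₂-zero {n} (λ _ → refl))
Σ₂-swap {suc m} {n} f = trans (cong (Σ₂ (f zero) xor_) (Σ₂-swap (λ i → f (suc i))))
                          (sym (Σ₂-xor (f zero) (λ j → Σ₂ (λ i → f (suc i) j))))

Σ₂-nonzero : ∀ {n} (f : Fin n → Bool) → Σ₂ f ≡ true → Σ (Fin n) λ i → f i ≡ true
Σ₂-nonzero {suc n} f e with f zero in f₀
... | true  = zero , f₀
... | false = let (i , fi) = Σ₂-nonzero (λ i → f (suc i)) e in suc i , fi

basis-eq : ∀ {n} (v w : Fin n) → basis v w ≡ true → v ≡ w
basis-eq zero    zero    e = refl
basis-eq (suc v) (suc w) e = cong suc (basis-eq v w e)

Σ₂-siftˡ : ∀ {n} (v : Fin n) (f : Fin n → Bool) → Σ₂ (λ i → basis v i ∧ f i) ≡ f v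
Σ₂-siftˡ {suc n} zero    f = trans (cong (f zero xor_) (Σ₂-zero {n} (λ _ → refl))) (xor-identityʳ (f zero))
Σ₂-siftˡ {suc n} (suc v) f = Σ₂-siftˡ v (λ i → f (suc i))

Σ₂-siftʳ : ∀ {n} (v : Fin n) (f : Fin n → Bool) → Σ₂ (λ i → f i ∧ basis v i) ≡ f v
Σ₂-siftʳ v f = trans (Σ₂-cong (λ i → ∧-comm (f i) (basis v i))) (Σ₂-siftˡ v f)

_⊆_ : ∀ {n} → Subset n → Subset n → Set
S ⊆ T = ∀ i → S i ≡ true → T i ≡ true

NonEmpty : ∀ {n} → Subset n → Set
NonEmpty {n} T = Σ (Fin n) λ i → T i ≡ true

∪-introˡ : ∀ {n} (S T : Subset n) {i} → S i ≡ true → (S ∪ T) i ≡ true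
∪-introˡ S T Si = subst (λ b → b ∨ T _ ≡ true) (sym Si) refl

∪-introʳ : ∀ {n} (S T : Subset n) {i} → T i ≡ true → (S ∪ T) i ≡ true
∪-introʳ S T Ti = trans (cong (S _ ∨_) Ti) (∨-zeroʳ (S _))

+ᵥ-⊆ : ∀ {n} {S T U : Subset n} → S ⊆ U → T ⊆ U → (S +ᵥ T) ⊆ U
+ᵥ-⊆ S⊆U T⊆U i e = [ S⊆U i , T⊆U i ]′ (xor-true e)

basis-⊆ : ∀ {n} {U : Subset n} i → U i ≡ true → basis i ⊆ U
basis-⊆ {U = U} i Ui k eik = subst (λ m → U m ≡ true) (basis-eq i k eik) Ui

card-cong : ∀ {n} {S T : Subset n} → S ≗ T → card S ≡ card T
card-cong {zero}  e = refl
card-cong {suc n} e = cong₂ _+_ (cong (λ b → if b then 1 else 0) (e zero)) (card-cong (λ i → e (suc i)))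

card-∅ : ∀ {n} → card {n} (λ _ → false) ≡ 0
card-∅ {zero}  = refl
card-∅ {suc n} = card-∅ {n}

card-∪-disjoint : ∀ {n} (S T : Subset n) → (∀ k → S k ∧ T k ≡ false) →
                  card (S ∪ T) ≡ card S + card T
card-∪-disjoint {zero}  S T disjoint = refl
card-∪-disjoint {suc n} S T disjoint
  with S zero | T zero | disjoint zero | card-∪-disjoint (tail S) (tail T) (λ k → disjoint (suc k))
... | false | false | _ | ih = ih
... | true  | false | _ | ih = cong suc ih
... | false | true  | _ | ih = trans (cong suc ih) (sym (+-suc (card (tail S)) (card (tail T))))
... | true  | true  | () | _

card-basis : ∀ {n} (k : Fin n) → card (basis k) ≡ 1
card-basis {suc n} zero    = cong suc (card-∅ {n})
card-basis {suc n} (suc k) = card-basis k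

card-insert : ∀ {n} (S : Subset n) k → S k ≡ false → card (S ∪ basis k) ≡ suc (card S)
card-insert S k Sk = begin
  card (S ∪ basis k)          ≡⟨ card-∪-disjoint S (basis k) disjoint ⟩
  card S + card (basis k)     ≡⟨ cong (card S +_) (card-basis k) ⟩
  card S + 1                  ≡⟨ +-comm (card S) 1 ⟩
  suc (card S)                ∎
  where
  open ≡-Reasoning
  disjoint : ∀ i → S i ∧ basis k i ≡ false
  disjoint i with basis k i in eki
  ... | false = ∧-zeroʳ (S i)
  ... | true  = trans (∧-identityʳ (S i)) (subst (λ x → S x ≡ false) (basis-eq k i eki) Sk)

comb : ∀ {n} → Matrix n → Subset n → Vec₂ n
comb M T j = Σ₂ (λ i → T i ∧ M i j)

vanishesOn : ∀ {n} → Vec₂ n → Subset n → Set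
vanishesOn x U = ∀ j → U j ≡ true → x j ≡ false

comb-cong : ∀ {n} (M : Matrix n) {S T : Subset n} → S ≗ T → comb M S ≗ comb M T
comb-cong M e j = Σ₂-cong (λ i → cong (_∧ M i j) (e i))

comb-xor : ∀ {n} (M : Matrix n) (S T : Subset n) j →
           comb M (S +ᵥ T) j ≡ comb M S j xor comb M T j
comb-xor {n} M S T j = trans (Σ₂-cong (λ i → ∧-distribʳ-xor (M i j) (S i) (T i))) (Σ₂-xor {n} _ _)

comb-basis : ∀ {n} (M : Matrix n) (i : Fin n) → comb M (basis i) ≗ M i
comb-basis M i j = Σ₂-siftˡ i (λ k → M k j)

comb-addRow : ∀ {n} (M : Matrix n) F i j → comb M (F +ᵥ basis i) j ≡ comb M F j xor M i j
comb-addRow M F i j = trans (comb-xor M F (basis i) j) (cong (comb M F j xor_) (comb-basis M i j))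

spans⇒vanishes : ∀ {n} (M : Matrix n) F i j → M i j ≡ comb M F j → comb M (F +ᵥ basis i) j ≡ false
spans⇒vanishes M F i j e =
  trans (comb-addRow M F i j) (subst (λ b → comb M F j xor b ≡ false) (sym e) (xor-same (comb M F j)))

vanishes⇒spans : ∀ {n} (M : Matrix n) F i j → comb M (F +ᵥ basis i) j ≡ false → M i j ≡ comb M F j
vanishes⇒spans M F i j e = sym (xor-≡ (trans (sym (comb-addRow M F i j)) e))

lin : ∀ {n} → Subset n → (Fin n → Subset n) → Subset n
lin a f k = Σ₂ (λ i → a i ∧ f i k)

comb-lin : ∀ {n} (M : Matrix n) a f j → comb M (lin a f) j ≡ Σ₂ (λ i → a i ∧ comb M (f i) j)
comb-lin {n} M a f j = begin
  Σ₂ (λ k → Σ₂ (λ i → a i ∧ f i k) ∧ M k j)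
    ≡⟨ Σ₂-cong (λ k → sym (Σ₂-∧ʳ (M k j) (λ i → a i ∧ f i k))) ⟩
  Σ₂ (λ k → Σ₂ (λ i → (a i ∧ f i k) ∧ M k j))
    ≡⟨ Σ₂-swap {n} {n} _ ⟩
  Σ₂ (λ i → Σ₂ (λ k → (a i ∧ f i k) ∧ M k j))
    ≡⟨ Σ₂-cong (λ i → Σ₂-cong {n} (λ k → ∧-assoc (a i) _ _)) ⟩
  Σ₂ (λ i → Σ₂ (λ k → a i ∧ (f i k ∧ M k j)))
    ≡⟨ Σ₂-cong (λ i → Σ₂-∧ˡ (a i) (λ k → f i k ∧ M k j)) ⟩
  Σ₂ (λ i → a i ∧ comb M (f i) j) ∎
  where open ≡-Reasoning

lin-⊆ : ∀ {n} a (f : Fin n → Subset n) K → (∀ i → f i ⊆ K) → lin a f ⊆ K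
lin-⊆ a f K f⊆K k e = let (i , hit) = Σ₂-nonzero _ e in f⊆K i k (∧-conicalʳ (a i) _ hit)

module Form {n} (G : Graph n) where

  A : Matrix n
  A = adj G

  ℰ-congˡ : ∀ {x x'} y → x ≗ x' → ℰ G x y ≡ ℰ G x' y
  ℰ-congˡ y e = Σ₂-cong (λ i → Σ₂-cong (λ j → cong (λ a → a ∧ A i j ∧ y j) (e i)))

  ℰ-congʳ : ∀ x {y y'} → y ≗ y' → ℰ G x y ≡ ℰ G x y'
  ℰ-congʳ x e = Σ₂-cong (λ i → Σ₂-cong (λ j → cong (λ b → x i ∧ A i j ∧ b) (e j)))

  ℰ-rows : ∀ x y → ℰ G x y ≡ Σ₂ (λ j → comb A x j ∧ y j)
  ℰ-rows x y = begin
    Σ₂ (λ i → Σ₂ (λ j → x i ∧ A i j ∧ y j))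
      ≡⟨ Σ₂-cong (λ i → Σ₂-cong {n} (λ j → sym (∧-assoc (x i) _ _))) ⟩
    Σ₂ (λ i → Σ₂ (λ j → (x i ∧ A i j) ∧ y j))
      ≡⟨ Σ₂-swap {n} {n} _ ⟩
    Σ₂ (λ j → Σ₂ (λ i → (x i ∧ A i j) ∧ y j))
      ≡⟨ Σ₂-cong (λ j → Σ₂-∧ʳ (y j) (λ i → x i ∧ A i j)) ⟩
    Σ₂ (λ j → comb A x j ∧ y j) ∎
    where open ≡-Reasoning

  ℰ-basisʳ : ∀ x j → ℰ G x (basis j) ≡ comb A x j
  ℰ-basisʳ x j = trans (ℰ-rows x (basis j)) (Σ₂-siftʳ j (comb A x))

  ℰ-vanish : ∀ x y → vanishesOn (comb A x) y → ℰ G x y ≡ false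
  ℰ-vanish x y v = trans (ℰ-rows x y) (Σ₂-zero term)
    where
    term : ∀ j → comb A x j ∧ y j ≡ false
    term j with y j in yj
    ... | false = ∧-zeroʳ _
    ... | true  = trans (∧-identityʳ _) (v j yj)

  ℰ-xorˡ : ∀ x y z → ℰ G (x +ᵥ y) z ≡ ℰ G x z xor ℰ G y z
  ℰ-xorˡ x y z = begin
    ℰ G (x +ᵥ y) z
      ≡⟨ ℰ-rows (x +ᵥ y) z ⟩
    Σ₂ (λ j → comb A (x +ᵥ y) j ∧ z j)
      ≡⟨ Σ₂-cong (λ j → cong (_∧ z j) (comb-xor A x y j)) ⟩
    Σ₂ (λ j → (comb A x j xor comb A y j) ∧ z j)
      ≡⟨ Σ₂-cong (λ j → ∧-distribʳ-xor (z j) (comb A x j) (comb A y j)) ⟩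
    Σ₂ (λ j → comb A x j ∧ z j xor comb A y j ∧ z j)
      ≡⟨ Σ₂-xor {n} _ _ ⟩
    Σ₂ (λ j → comb A x j ∧ z j) xor Σ₂ (λ j → comb A y j ∧ z j)
      ≡⟨ sym (cong₂ _xor_ (ℰ-rows x z) (ℰ-rows y z)) ⟩
    ℰ G x z xor ℰ G y z ∎
    where open ≡-Reasoning

  ℰ-xorʳ : ∀ x y z → ℰ G x (y +ᵥ z) ≡ ℰ G x y xor ℰ G x z
  ℰ-xorʳ x y z = begin
    ℰ G x (y +ᵥ z)
      ≡⟨ ℰ-rows x (y +ᵥ z) ⟩
    Σ₂ (λ j → comb A x j ∧ (y j xor z j))
      ≡⟨ Σ₂-cong (λ j → ∧-distribˡ-xor (comb A x j) (y j) (z j)) ⟩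
    Σ₂ (λ j → comb A x j ∧ y j xor comb A x j ∧ z j)
      ≡⟨ Σ₂-xor {n} _ _ ⟩
    Σ₂ (λ j → comb A x j ∧ y j) xor Σ₂ (λ j → comb A x j ∧ z j)
      ≡⟨ sym (cong₂ _xor_ (ℰ-rows x y) (ℰ-rows x z)) ⟩
    ℰ G x y xor ℰ G x z ∎
    where open ≡-Reasoning

  ℰ-sym : ∀ x y → ℰ G x y ≡ ℰ G y x
  ℰ-sym x y = trans (Σ₂-swap {n} {n} _)
                    (Σ₂-cong (λ j → Σ₂-cong (λ i → mirror (x i) (A i j) (y j) (Graph.sym G i j))))
    where
    mirror : ∀ a b c {b'} → b ≡ b' → a ∧ b ∧ c ≡ c ∧ b' ∧ a
    mirror false b false refl = refl
    mirror false b true  refl = sym (∧-zeroʳ b)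
    mirror true  b false refl = ∧-zeroʳ b
    mirror true  b true  refl = refl

  ℰ-expandˡ : ∀ x y → Σ₂ (λ i → x i ∧ ℰ G (basis i) y) ≡ ℰ G x y
  ℰ-expandˡ x y = begin
    Σ₂ (λ i → x i ∧ ℰ G (basis i) y)
      ≡⟨ Σ₂-cong (λ i → cong (x i ∧_) (trans (ℰ-sym (basis i) y) (ℰ-basisʳ y i))) ⟩
    Σ₂ (λ i → x i ∧ comb A y i)
      ≡⟨ Σ₂-cong (λ i → ∧-comm (x i) _) ⟩
    Σ₂ (λ i → comb A y i ∧ x i)
      ≡⟨ sym (ℰ-rows y x) ⟩
    ℰ G y x
      ≡⟨ ℰ-sym y x ⟩
    ℰ G x y ∎
    where open ≡-Reasoning

any₂-witness : ∀ {n} (f : Fin n → Bool) → any₂ f ≡ true → Σ (Fin n) λ i → f i ≡ true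
any₂-witness {suc n} f e with f zero in f₀
... | true  = zero , f₀
... | false = let (i , fi) = any₂-witness (λ i → f (suc i)) e in suc i , fi

any₂-intro : ∀ {n} (f : Fin n → Bool) i → f i ≡ true → any₂ f ≡ true
any₂-intro f zero    e rewrite e = refl
any₂-intro f (suc i) e with f zero
... | true  = refl
... | false = any₂-intro (λ i → f (suc i)) i e

any₂-none : ∀ {n} (f : Fin n → Bool) → any₂ f ≡ false → ∀ i → f i ≡ false
any₂-none f e i with f i in fi
... | false = refl
... | true  = ⊥-elim (true≢false (trans (sym (any₂-intro f i fi)) e))

all₂-elim : ∀ {n} (f : Fin n → Bool) → all₂ f ≡ true → ∀ i → f i ≡ true
all₂-elim f e zero    = ∧-conicalˡ _ _ e
all₂-elim f e (suc i) = all₂-elim (λ i → f (suc i)) (∧-conicalʳ (f zero) _ e) i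

all₂-intro : ∀ {n} (f : Fin n → Bool) → (∀ i → f i ≡ true) → all₂ f ≡ true
all₂-intro {zero}  f h = refl
all₂-intro {suc n} f h rewrite h zero = all₂-intro (λ i → f (suc i)) (λ i → h (suc i))

⊆ᵇ-sound : ∀ {n} (S T : Subset n) → S ⊆ᵇ T ≡ true → S ⊆ T
⊆ᵇ-sound S T e i Si with all₂-elim _ e i
... | Ti rewrite Si = Ti

⊆ᵇ-complete : ∀ {n} (S T : Subset n) → S ⊆ T → S ⊆ᵇ T ≡ true
⊆ᵇ-complete S T h = all₂-intro _ implication
  where
  implication : ∀ i → not (S i) ∨ T i ≡ true
  implication i with S i in Si
  ... | false = refl
  ... | true  = h i Si

Dependency : ∀ {n} → Matrix n → Subset n → Subset n → Set
Dependency {n} M U₂ S = Σ (Subset n) λ T → T ⊆ S × NonEmpty T × vanishesOn (comb M T) U₂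

Independent : ∀ {n} → Matrix n → Subset n → Subset n → Set
Independent M U₂ S = ¬ Dependency M U₂ S

allSubsets-complete : ∀ {n} (S : Subset n) → Any (S ≗_) (allSubsets n)
allSubsets-complete {zero}  S = here (λ ())
allSubsets-complete {suc n} S =
  Anyₚ.concatMap⁺ _ (Any.map extend (allSubsets-complete (λ i → S (suc i))))
  where
  extend : ∀ {T} → (λ i → S (suc i)) ≗ T → Any (S ≗_) _
  extend e with S zero in S₀
  ... | false = here λ { zero → S₀ ; (suc i) → e i }
  ... | true  = there (here λ { zero → S₀ ; (suc i) → e i })

module _ {A : Set} (p : A → Bool) where

  conj : List A → Bool
  conj = foldr (λ x r → r ∧ p x) true

  conj-elim : ∀ xs → conj xs ≡ true → All (λ x → p x ≡ true) xs
  conj-elim []       e = []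
  conj-elim (x ∷ xs) e = ∧-conicalʳ _ _ e ∷ conj-elim xs (∧-conicalˡ _ _ e)

  conj-intro : ∀ xs → All (λ x → p x ≡ true) xs → conj xs ≡ true
  conj-intro []       []       = refl
  conj-intro (x ∷ xs) (px ∷ ps) rewrite conj-intro xs ps = px

  conj-false : ∀ xs → conj xs ≡ false → Any (λ x → p x ≡ false) xs
  conj-false (x ∷ xs) e with p x in px
  ... | false = here px
  ... | true  = there (conj-false xs (trans (sym (∧-identityʳ _)) e))

module _ {n} (M : Matrix n) (U₂ S : Subset n) where

  passes : Subset n → Bool
  passes T = not (T ⊆ᵇ S ∧ any₂ T) ∨ any₂ (λ j → U₂ j ∧ comb M T j)

  passes-false : ∀ T → passes T ≡ false → T ⊆ S × NonEmpty T × vanishesOn (comb M T) U₂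
  passes-false T e =
    ⊆ᵇ-sound T S (∧-conicalˡ _ _ candidate) , any₂-witness T (∧-conicalʳ (T ⊆ᵇ S) _ candidate) ,
    vanishes
    where
    candidate : T ⊆ᵇ S ∧ any₂ T ≡ true
    candidate = not-false (∨-conicalˡ _ _ e)
    vanishes : vanishesOn (comb M T) U₂
    vanishes j U₂j = subst (λ b → b ∧ comb M T j ≡ false) U₂j (any₂-none _ (∨-conicalʳ _ _ e) j)

  passes-true : ∀ T → passes T ≡ true → ¬ (T ⊆ S × NonEmpty T × vanishesOn (comb M T) U₂)
  passes-true T e (T⊆S , (i , Ti) , vanishes) = noColumn (any₂-witness (λ j → U₂ j ∧ comb M T j) column)
    where
    column : any₂ (λ j → U₂ j ∧ comb M T j) ≡ true
    column = subst (λ b → not b ∨ _ ≡ true) (cong₂ _∧_ (⊆ᵇ-complete T S T⊆S) (any₂-intro T i Ti)) e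
    noColumn : ¬ Σ (Fin n) (λ j → U₂ j ∧ comb M T j ≡ true)
    noColumn (j , hit) = true≢false (trans (sym (∧-conicalʳ (U₂ j) _ hit)) (vanishes j (∧-conicalˡ _ _ hit)))

  rowsIndependent-sound : rowsIndependent M U₂ S ≡ true → Independent M U₂ S
  rowsIndependent-sound e (T , T⊆S , (i , Ti) , vanishes) =
    passes-true T' (proj₁ found) ( (λ k T'k → T⊆S k (trans (T≗T' k) T'k))
                                 , (i , trans (sym (T≗T' i)) Ti)
                                 , (λ j U₂j → trans (sym (comb-cong M T≗T' j)) (vanishes j U₂j)))
    where
    T∈ : Any (T ≗_) (allSubsets n)
    T∈ = allSubsets-complete T
    T' : Subset n
    T' = Any.lookup T∈
    found : passes T' ≡ true × T ≗ T'
    found = All.lookupAny (conj-elim passes (allSubsets n) e) T∈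
    T≗T' : T ≗ T'
    T≗T' = proj₂ found

  rowsIndependent-complete : Independent M U₂ S → rowsIndependent M U₂ S ≡ true
  rowsIndependent-complete ind = conj-intro passes (allSubsets n) (All.universal test (allSubsets n))
    where
    test : ∀ T → passes T ≡ true
    test T with passes T in e
    ... | true  = refl
    ... | false = ⊥-elim (ind (T , passes-false T e))

  rowsDependent : rowsIndependent M U₂ S ≡ false → Dependency M U₂ S
  rowsDependent e = let (T , fails) = Any.satisfied (conj-false passes (allSubsets n) e)
                    in T , passes-false T fails

module _ {A : Set} (p : A → Bool) (c : A → ℕ) where

  maxWhere : List A → ℕ
  maxWhere = foldr (λ x r → if p x then c x ⊔ r else r) 0

  maxWhere-upper : ∀ {k} xs → Any (λ x → p x ≡ true × k ≤ c x) xs → k ≤ maxWhere xs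
  maxWhere-upper (x ∷ xs) (here (px , k≤cx)) rewrite px = ≤-trans k≤cx (m≤m⊔n _ _)
  maxWhere-upper (x ∷ xs) (there hit) with p x
  ... | true  = ≤-trans (maxWhere-upper xs hit) (m≤n⊔m _ _)
  ... | false = maxWhere-upper xs hit

  maxWhere-attained : ∀ xs → maxWhere xs ≡ 0 ⊎ Σ A λ x → p x ≡ true × c x ≡ maxWhere xs
  maxWhere-attained [] = inj₁ refl
  maxWhere-attained (x ∷ xs) with p x in px
  ... | false = maxWhere-attained xs
  ... | true with ≤-total (c x) (maxWhere xs) | maxWhere-attained xs
  ...   | inj₂ rest≤cx | _                   = inj₂ (x , px , sym (m≥n⇒m⊔n≡m rest≤cx))
  ...   | inj₁ cx≤rest | inj₁ rest≡0          =
          inj₂ (x , px , sym (trans (cong (c x ⊔_) rest≡0) (m≥n⇒m⊔n≡m z≤n)))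
  ...   | inj₁ cx≤rest | inj₂ (y , py , cy≡) = inj₂ (y , py , trans cy≡ (sym (m≤n⇒m⊔n≡n cx≤rest)))

record RowBasis {n} (M : Matrix n) (U₁ U₂ : Subset n) : Set where
  field
    rows        : Subset n
    rows⊆       : rows ⊆ U₁
    independent : Independent M U₂ rows
    card≡rank   : card rows ≡ rank M U₁ U₂

module _ {n} (M : Matrix n) (U₁ U₂ : Subset n) where

  private
    candidate : Subset n → Bool
    candidate S = (S ⊆ᵇ U₁) ∧ rowsIndependent M U₂ S

  rank-upper : ∀ S → S ⊆ U₁ → Independent M U₂ S → card S ≤ rank M U₁ U₂
  rank-upper S S⊆U₁ ind = maxWhere-upper candidate card (allSubsets n) (Any.map qualifies (allSubsets-complete S))
    where
    qualifies : ∀ {T} → S ≗ T → candidate T ≡ true × card S ≤ card T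
    qualifies S≗T =
      cong₂ _∧_ (⊆ᵇ-complete _ U₁ (λ i Ti → S⊆U₁ i (trans (S≗T i) Ti)))
                (rowsIndependent-complete M U₂ _
                  (λ (T , T⊆ , dep) → ind (T , (λ i Ti → trans (S≗T i) (T⊆ i Ti)) , dep)))
      , ≤-reflexive (card-cong S≗T)

  rowBasis : RowBasis M U₁ U₂
  rowBasis with maxWhere-attained candidate card (allSubsets n)
  ... | inj₁ rank≡0 = record
    { rows = λ _ → false ; rows⊆ = λ _ ()
    ; independent = λ (T , T⊆∅ , (i , Ti) , _) → true≢false (sym (T⊆∅ i Ti))
    ; card≡rank = trans (card-∅ {n}) (sym rank≡0) }
  ... | inj₂ (S , ok , card≡) = record
    { rows = S ; rows⊆ = ⊆ᵇ-sound S U₁ (∧-conicalˡ _ _ ok)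
    ; independent = rowsIndependent-sound M U₂ S (∧-conicalʳ (S ⊆ᵇ U₁) _ ok) ; card≡rank = card≡ }

  rank-exceeded : ∀ S → S ⊆ U₁ → rank M U₁ U₂ < card S → Dependency M U₂ S
  rank-exceeded S S⊆U₁ rank<card with rowsIndependent M U₂ S in e
  ... | false = rowsDependent M U₂ S e
  ... | true  = ⊥-elim (<⇒≱ rank<card (rank-upper S S⊆U₁ (rowsIndependent-sound M U₂ S e)))

-- A map Φ sending subsets of S injectively to subsets of K then forces
-- 2^|S| ≤ 2^|K| by the pigeonhole principle, i.e. |S| ≤ |K|.

extend : ∀ {n} → Bool → List (Subset n) → List (Subset (suc n))
extend false L = map (false ◂_) L
extend true  L = map (false ◂_) L ++ map (true ◂_) L

subsetsOf : ∀ {n} → Subset n → List (Subset n)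
subsetsOf {zero}  S = (λ ()) ∷ []
subsetsOf {suc n} S = extend (S zero) (subsetsOf (tail S))

subsetsOf-length : ∀ {n} (S : Subset n) → length (subsetsOf S) ≡ 2 ^ card S
subsetsOf-length {zero}  S = refl
subsetsOf-length {suc n} S = extend-length (S zero) (subsetsOf-length (tail S))
  where
  L : List (Subset n)
  L = subsetsOf (tail S)
  extend-length : ∀ b → length L ≡ 2 ^ card (tail S) →
                  length (extend b L) ≡ 2 ^ ((if b then 1 else 0) + card (tail S))
  extend-length false e = trans (length-map _ L) e
  extend-length true  e = begin
    length (map (false ◂_) L ++ map (true ◂_) L)
      ≡⟨ length-++ (map (false ◂_) L) ⟩
    length (map (false ◂_) L) + length (map (true ◂_) L)
      ≡⟨ cong₂ _+_ (trans (length-map _ L) e) (trans (length-map _ L) e) ⟩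
    2 ^ card (tail S) + 2 ^ card (tail S)
      ≡⟨ cong (2 ^ card (tail S) +_) (sym (+-identityʳ _)) ⟩
    2 ^ suc (card (tail S)) ∎
    where open ≡-Reasoning

subsetsOf-⊆ : ∀ {n} (S : Subset n) → All (_⊆ S) (subsetsOf S)
subsetsOf-⊆ {zero}  S = (λ ()) ∷ []
subsetsOf-⊆ {suc n} S = extend-⊆ (S zero) refl (subsetsOf-⊆ (tail S))
  where
  prefix : ∀ {T} b → (b ≡ true → S zero ≡ true) → T ⊆ tail S → (b ◂ T) ⊆ S
  prefix b head⊆ T⊆ zero    = head⊆
  prefix b head⊆ T⊆ (suc i) = T⊆ i
  extend-⊆ : ∀ b → S zero ≡ b → ∀ {L} → All (_⊆ tail S) L → All (_⊆ S) (extend b L)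
  extend-⊆ false _  all⊆ = Allₚ.map⁺ (All.map (prefix false λ ()) all⊆)
  extend-⊆ true  S₀ all⊆ = Allₚ.++⁺ (Allₚ.map⁺ (All.map (prefix false λ ()) all⊆))
                                    (Allₚ.map⁺ (All.map (prefix true λ _ → S₀) all⊆))

subsetsOf-complete : ∀ {n} (S T : Subset n) → T ⊆ S → Any (T ≗_) (subsetsOf S)
subsetsOf-complete {zero}  S T T⊆S = here (λ ())
subsetsOf-complete {suc n} S T T⊆S =
  extend-complete (S zero) refl (subsetsOf-complete (tail S) (tail T) (λ i → T⊆S (suc i)))
  where
  prefix : ∀ {c T'} → T zero ≡ c → tail T ≗ T' → T ≗ (c ◂ T')
  prefix T₀ e zero    = T₀
  prefix T₀ e (suc i) = e i
  extend-complete : ∀ b → S zero ≡ b → ∀ {L} → Any (tail T ≗_) L → Any (T ≗_) (extend b L)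
  extend-complete b S₀ hit with T zero in T₀
  extend-complete false S₀     hit | false = Anyₚ.map⁺ (Any.map (prefix T₀) hit)
  extend-complete true  S₀     hit | false = Anyₚ.++⁺ˡ (Anyₚ.map⁺ (Any.map (prefix T₀) hit))
  extend-complete false S₀     hit | true  = ⊥-elim (true≢false (trans (sym (T⊆S zero T₀)) S₀))
  extend-complete true  S₀ {L} hit | true  =
    Anyₚ.++⁺ʳ (map (false ◂_) L) (Anyₚ.map⁺ (Any.map (prefix T₀) hit))

Distinct : ∀ {n} → Subset n → Subset n → Set
Distinct T T' = ¬ (T ≗ T')

subsetsOf-distinct : ∀ {n} (S : Subset n) → AllPairs Distinct (subsetsOf S)
subsetsOf-distinct {zero}  S = [] ∷ []
subsetsOf-distinct {suc n} S = extend-distinct (S zero) (subsetsOf-distinct (tail S))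
  where
  sameHead : ∀ {b} {T T' : Subset n} → Distinct T T' → Distinct (b ◂ T) (b ◂ T')
  sameHead T≢T' e = T≢T' (λ i → e (suc i))
  extend-distinct : ∀ b {L} → AllPairs Distinct L → AllPairs Distinct (extend b L)
  extend-distinct false d = AllPairsₚ.map⁺ (AllPairs.map sameHead d)
  extend-distinct true {L} d =
    AllPairsₚ.++⁺ (AllPairsₚ.map⁺ (AllPairs.map sameHead d)) (AllPairsₚ.map⁺ (AllPairs.map sameHead d))
                  (Allₚ.map⁺ (All.universal (λ _ → Allₚ.map⁺ (All.universal differentHead L)) L))
    where
    differentHead : ∀ {T} T' → Distinct (false ◂ T) (true ◂ T')
    differentHead _ e = true≢false (sym (e zero))

Any-─ : ∀ {A : Set} {P Q : A → Set} {zs : List A} (p : Any P zs) → Any Q zs →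
        (Σ A λ z → P z × Q z) ⊎ Any Q (zs Any.─ p)
Any-─ (here p)  (here q)  = inj₁ (_ , p , q)
Any-─ (here p)  (there q) = inj₂ q
Any-─ (there p) (here q)  = inj₂ (here q)
Any-─ (there p) (there q) with Any-─ p q
... | inj₁ both = inj₁ both
... | inj₂ q'   = inj₂ (there q')

pigeonhole : ∀ {n} (xs ys : List (Subset n)) →
             AllPairs Distinct xs → All (λ T → Any (T ≗_) ys) xs → length xs ≤ length ys
pigeonhole []       ys _               _              = z≤n
pigeonhole (x ∷ xs) ys (x≢ ∷ distinct) (x∈ys ∷ xs∈ys) =
  subst (suc (length xs) ≤_) (sym (length-removeAt′ ys (Any.index x∈ys)))
        (s≤s (pigeonhole xs (ys Any.─ x∈ys) distinct (All.zipWith stillIn (x≢ , xs∈ys))))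
  where
  stillIn : ∀ {x'} → Distinct x x' × Any (x' ≗_) ys → Any (x' ≗_) (ys Any.─ x∈ys)
  stillIn (x≢x' , x'∈ys) with Any-─ x∈ys x'∈ys
  ... | inj₁ (_ , e , e') = ⊥-elim (x≢x' (λ i → trans (e i) (sym (e' i))))
  ... | inj₂ x'∈rest      = x'∈rest

AllPairs-strengthen : ∀ {A : Set} {R R' : A → A → Set} {P : A → Set} {xs} →
  (∀ {a b} → P a → P b → R a b → R' a b) → All P xs → AllPairs R xs → AllPairs R' xs
AllPairs-strengthen f []        []        = []
AllPairs-strengthen f (pa ∷ ps) (ra ∷ rs) =
  All.zipWith (λ (pb , rab) → f pa pb rab) (ps , ra) ∷ AllPairs-strengthen f ps rs

2^-cancel : ∀ a b → 2 ^ a ≤ 2 ^ b → a ≤ b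
2^-cancel a b 2^a≤2^b = ≮⇒≥ (λ b<a → <⇒≱ (^-monoʳ-< 2 (s≤s (s≤s z≤n)) b<a) 2^a≤2^b)

card-≤-by-injection : ∀ {n} (S K : Subset n) (Φ : Subset n → Subset n) →
  (∀ T → T ⊆ S → Φ T ⊆ K) → (∀ T T' → T ⊆ S → T' ⊆ S → Φ T ≗ Φ T' → T ≗ T') →
  card S ≤ card K
card-≤-by-injection S K Φ into injective = 2^-cancel (card S) (card K) (begin
  2 ^ card S
    ≡⟨ sym (subsetsOf-length S) ⟩
  length (subsetsOf S)
    ≡⟨ sym (length-map Φ (subsetsOf S)) ⟩
  length (map Φ (subsetsOf S))
    ≤⟨ pigeonhole (map Φ (subsetsOf S)) (subsetsOf K) images-distinct images-in-K ⟩
  length (subsetsOf K)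
    ≡⟨ subsetsOf-length K ⟩
  2 ^ card K ∎)
  where
  open ≤-Reasoning
  images-distinct : AllPairs Distinct (map Φ (subsetsOf S))
  images-distinct =
    AllPairsₚ.map⁺ (AllPairs-strengthen (λ T⊆ T'⊆ T≢T' → T≢T' ∘ injective _ _ T⊆ T'⊆)
                                        (subsetsOf-⊆ S) (subsetsOf-distinct S))
  images-in-K : All (λ T → Any (T ≗_) (subsetsOf K)) (map Φ (subsetsOf S))
  images-in-K = Allₚ.map⁺ (All.map (λ T⊆ → subsetsOf-complete K _ (into _ T⊆)) (subsetsOf-⊆ S))

Spans : ∀ {n} → Matrix n → Subset n → Subset n → Fin n → Set
Spans {n} M U₂ K i = Σ (Subset n) λ F → F ⊆ K × (∀ j → U₂ j ≡ true → M i j ≡ comb M F j)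

record Spanning {n} (M : Matrix n) (U₁ U₂ K : Subset n) : Set where
  field
    coeffs  : Fin n → Subset n
    coeffs⊆ : ∀ i → coeffs i ⊆ K
    spans   : ∀ i → U₁ i ≡ true → ∀ j → U₂ j ≡ true → M i j ≡ comb M (coeffs i) j

spanning : ∀ {n} (M : Matrix n) {U₁ U₂ K} →
           (∀ i → U₁ i ≡ true → Spans M U₂ K i) → Spanning M U₁ U₂ K
spanning {n} M {U₁} {U₂} {K} span = record
  { coeffs  = λ i → proj₁ (choice i)
  ; coeffs⊆ = λ i → proj₁ (proj₂ (choice i))
  ; spans   = λ i → proj₂ (proj₂ (choice i))
  }
  where
  choice : ∀ i → Σ (Subset n) λ F →
           F ⊆ K × (U₁ i ≡ true → ∀ j → U₂ j ≡ true → M i j ≡ comb M F j)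
  choice i with U₁ i in U₁i
  ... | true  = let (F , F⊆K , agrees) = span i U₁i in F , F⊆K , λ _ → agrees
  ... | false = (λ _ → false) , (λ _ ()) , λ ()

spanned-by-dependency : ∀ {n} (M : Matrix n) U₂ S i → Independent M U₂ S →
                        Dependency M U₂ (S ∪ basis i) → Spans M U₂ S i
spanned-by-dependency M U₂ S i ind (T , T⊆ , nonempty , vanishes) with T i in Ti
... | false = ⊥-elim (ind (T , T⊆S , nonempty , vanishes))
  where
  T⊆S : T ⊆ S
  T⊆S k Tk with ∨-true (T⊆ k Tk)
  ... | inj₁ Sk = Sk
  ... | inj₂ eik = ⊥-elim (true≢false (trans (sym Tk) (subst (λ x → T x ≡ false) (basis-eq i k eik) Ti)))
... | true = T +ᵥ basis i , F⊆S , λ j U₂j → vanishes⇒spans M (T +ᵥ basis i) i j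
                                  (trans (comb-cong M (λ k → xor-cancelʳ (T k) (basis i k)) j) (vanishes j U₂j))
  where
  F⊆S : (T +ᵥ basis i) ⊆ S
  F⊆S k Fk with T k in Tk | basis i k in eik
  F⊆S k () | false | false
  F⊆S k () | true  | true
  ... | true  | false =
    [ (λ Sk → Sk) , (λ eik' → ⊥-elim (true≢false (trans (sym eik') eik))) ]′ (∨-true (T⊆ k Tk))
  ... | false | true  =
    ⊥-elim (true≢false (trans (sym Ti) (subst (λ x → T x ≡ false) (sym (basis-eq i k eik)) Tk)))

-- A row basis spans every row of U₁: otherwise adding the row would give an
-- independent set larger than the rank.
module _ {n} {M : Matrix n} {U₁ U₂ : Subset n} (B : RowBasis M U₁ U₂) where

  open RowBasis B

  rowBasis-spans : ∀ i → U₁ i ≡ true → Spans M U₂ rows i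
  rowBasis-spans i U₁i with rows i in rowsi
  ... | true  = basis i , basis-⊆ i rowsi , λ j _ → sym (comb-basis M i j)
  ... | false = spanned-by-dependency M U₂ rows i independent
                  (rank-exceeded M U₁ U₂ (rows ∪ basis i) enlarged⊆U₁ rank<card)
    where
    enlarged⊆U₁ : (rows ∪ basis i) ⊆ U₁
    enlarged⊆U₁ k e = [ rows⊆ k , basis-⊆ i U₁i k ]′ (∨-true e)
    rank<card : rank M U₁ U₂ < card (rows ∪ basis i)
    rank<card = subst₂ _<_ card≡rank (sym (card-insert rows i rowsi)) (n<1+n (card rows))

spanning-lin : ∀ {n} (M : Matrix n) {U₁ U₂ K} (sp : Spanning M U₁ U₂ K) T → T ⊆ U₁ →
               ∀ j → U₂ j ≡ true → comb M (lin T (Spanning.coeffs sp)) j ≡ comb M T j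
spanning-lin M sp T T⊆U₁ j U₂j = trans (comb-lin M T coeffs j) (Σ₂-cong agree)
  where
  open Spanning sp
  agree : ∀ i → T i ∧ comb M (coeffs i) j ≡ T i ∧ M i j
  agree i with T i in Ti
  ... | false = refl
  ... | true  = sym (spans i (T⊆U₁ i Ti) j U₂j)

-- Rank is at most the size of any set of rows spanning all rows of U₁ on U₂:
-- T ↦ Σ_{i∈T} coeffs i is injective on the subsets of a row basis.
rank-≤-spanning : ∀ {n} (M : Matrix n) U₁ U₂ K → Spanning M U₁ U₂ K → rank M U₁ U₂ ≤ card K
rank-≤-spanning M U₁ U₂ K sp =
  subst (_≤ card K) card≡rank
        (card-≤-by-injection rows K (λ T → lin T coeffs) (λ T _ → lin-⊆ T coeffs K coeffs⊆) injective)
  where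
  open RowBasis (rowBasis M U₁ U₂)
  open Spanning sp
  lin-agrees : ∀ T → T ⊆ rows → ∀ j → U₂ j ≡ true → comb M (lin T coeffs) j ≡ comb M T j
  lin-agrees T T⊆ = spanning-lin M sp T (λ i Ti → rows⊆ i (T⊆ i Ti))
  injective : ∀ T T' → T ⊆ rows → T' ⊆ rows → lin T coeffs ≗ lin T' coeffs → T ≗ T'
  injective T T' T⊆ T'⊆ same with any₂ (T +ᵥ T') in differ
  ... | false = λ i → xor-≡ (any₂-none (T +ᵥ T') differ i)
  ... | true  = ⊥-elim (independent (T +ᵥ T' , D⊆ , any₂-witness (T +ᵥ T') differ , vanishes))
    where
    D⊆ : (T +ᵥ T') ⊆ rows
    D⊆ = +ᵥ-⊆ T⊆ T'⊆
    vanishes : vanishesOn (comb M (T +ᵥ T')) U₂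
    vanishes j U₂j = begin
      comb M (T +ᵥ T') j
        ≡⟨ comb-xor M T T' j ⟩
      comb M T j xor comb M T' j
        ≡⟨ sym (cong₂ _xor_ (lin-agrees T T⊆ j U₂j) (lin-agrees T' T'⊆ j U₂j)) ⟩
      comb M (lin T coeffs) j xor comb M (lin T' coeffs) j
        ≡⟨ cong (_xor comb M (lin T' coeffs) j) (comb-cong M same j) ⟩
      comb M (lin T' coeffs) j xor comb M (lin T' coeffs) j
        ≡⟨ xor-same (comb M (lin T' coeffs) j) ⟩
      false ∎
      where open ≡-Reasoning

module Reduction {n} (G : Graph n) (W : Subset n) (reducible : Reducible G W) (R : Representatives G W) where

  open Form G

  ⊥-orthogonal : ∀ b w → b ∈⟨ W ⟩⊥[ G ] → w ∈⟨ W ⟩ → ℰ G w b ≡ false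
  ⊥-orthogonal b w b⊥ w∈ = trans (ℰ-sym w b) (b⊥ w w∈)

  -- If z ∈ ⟨W⟩ is ℰ-orthogonal to all e_j (j ∈ W), it is orthogonal to all
  -- of 𝒱 = ⟨W⟩ + ⟨W⟩^⊥; so its row combination vanishes on every column.
  radical : ∀ z → z ∈⟨ W ⟩ → vanishesOn (comb A z) W → ∀ j → comb A z j ≡ false
  radical z z∈ vanishes j with reducible (basis j)
  ... | a , b , a∈ , b⊥ , split = begin
    comb A z j
      ≡⟨ sym (ℰ-basisʳ z j) ⟩
    ℰ G z (basis j)
      ≡⟨ ℰ-congʳ z split ⟩
    ℰ G z (a +ᵥ b)
      ≡⟨ ℰ-xorʳ z a b ⟩
    ℰ G z a xor ℰ G z b
      ≡⟨ cong₂ _xor_ (ℰ-vanish z a (λ k ak → vanishes k (a∈ k ak))) (⊥-orthogonal b z b⊥ z∈) ⟩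
    false ∎
    where open ≡-Reasoning

  correction : Fin n → Vec₂ n
  correction v = basis v +ᵥ rep R v

  rep-split : ∀ v → rep R v ≗ (basis v +ᵥ correction v)
  rep-split v k = sym (xor-cancelˡ (basis v k) (rep R v k))

  basis-split : ∀ v → basis v ≗ (rep R v +ᵥ correction v)
  basis-split v k = sym (trans (cong (rep R v k xor_) (xor-comm (basis v k) (rep R v k)))
                               (xor-cancelˡ (rep R v k) (basis v k)))

  rep-support : ∀ v → W v ≡ false → rep R v ⊆ (W ∪ basis v)
  rep-support v Wv k rk with basis v k in evk
  ... | true  = ∨-zeroʳ (W k)
  ... | false = trans (∨-identityʳ (W k)) (rep-dif R v Wv k (trans (cong (_xor rep R v k) evk) rk))

  -- The entry ℰ(v',w') of Γ_W(G) equals ℰ(e_v,w'), as ℰ(d_v,w') = 0.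
  Γ-entry : ∀ v w → W v ≡ false → W w ≡ false → Γ G W R v w ≡ ℰ G (basis v) (rep R w)
  Γ-entry v w Wv Ww = begin
    ℰ G (rep R v) (rep R w)
      ≡⟨ ℰ-congˡ (rep R w) (rep-split v) ⟩
    ℰ G (basis v +ᵥ correction v) (rep R w)
      ≡⟨ ℰ-xorˡ (basis v) (correction v) (rep R w) ⟩
    ℰ G (basis v) (rep R w) xor ℰ G (correction v) (rep R w)
      ≡⟨ cong (ℰ G (basis v) (rep R w) xor_)
              (⊥-orthogonal (rep R w) (correction v) (rep-⊥ R w Ww) (rep-dif R v Wv)) ⟩
    ℰ G (basis v) (rep R w) xor false
      ≡⟨ xor-identityʳ _ ⟩
    ℰ G (basis v) (rep R w) ∎
    where open ≡-Reasoning

  Γ-comb : ∀ T j → T ⊆∁ W → W j ≡ false → comb (Γ G W R) T j ≡ ℰ G T (rep R j)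
  Γ-comb T j T∁ Wj = trans (Σ₂-cong entry) (ℰ-expandˡ T (rep R j))
    where
    entry : ∀ i → T i ∧ Γ G W R i j ≡ T i ∧ ℰ G (basis i) (rep R j)
    entry i with T i in Ti
    ... | false = refl
    ... | true  = Γ-entry i j (T∁ i Ti) Wj

  vanishes⇒orthogonal : ∀ {X} → X ⊆∁ W → ∀ x → vanishesOn (comb A x) (W ∪ X) →
                        ∀ j → X j ≡ true → ℰ G x (rep R j) ≡ false
  vanishes⇒orthogonal {X} X∁ x vanishes j Xj = ℰ-vanish x (rep R j) (λ k rk → vanishes k (support k rk))
    where
    support : rep R j ⊆ (W ∪ X)
    support k rk with ∨-true (rep-support j (X∁ j Xj) k rk)
    ... | inj₁ Wk  = subst (λ b → b ∨ X k ≡ true) (sym Wk) refl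
    ... | inj₂ ejk = trans (cong (W k ∨_) (subst (λ m → X m ≡ true) (basis-eq j k ejk) Xj)) (∨-zeroʳ (W k))

  orthogonal⇒vanishes : ∀ {X} → X ⊆∁ W → ∀ x → vanishesOn (comb A x) W →
                        (∀ j → X j ≡ true → ℰ G x (rep R j) ≡ false) → vanishesOn (comb A x) (W ∪ X)
  orthogonal⇒vanishes X∁ x onW orthogonal k e with ∨-true e
  ... | inj₁ Wk = onW k Wk
  ... | inj₂ Xk = begin
    comb A x k
      ≡⟨ sym (ℰ-basisʳ x k) ⟩
    ℰ G x (basis k)
      ≡⟨ ℰ-congʳ x (basis-split k) ⟩
    ℰ G x (rep R k +ᵥ correction k)
      ≡⟨ ℰ-xorʳ x (rep R k) (correction k) ⟩
    ℰ G x (rep R k) xor ℰ G x (correction k)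
      ≡⟨ cong₂ _xor_ (orthogonal k Xk)
                     (ℰ-vanish x (correction k) (λ m dm → onW m (rep-dif R k (X∁ k Xk) m dm))) ⟩
    false ∎
    where open ≡-Reasoning

module RankFormula {n} (G : Graph n) (W : Subset n) (reducible : Reducible G W) (R : Representatives G W)
                   {W₁ W₂ : Subset n} (W₁∁ : W₁ ⊆∁ W) (W₂∁ : W₂ ⊆∁ W) where

  open Form G
  open Reduction G W reducible R

  ΓW : Matrix n
  ΓW = Γ G W R

  module B = RowBasis (rowBasis A W W)
  module C = RowBasis (rowBasis ΓW W₁ W₂)

  K : Subset n
  K = B.rows ∪ C.rows

  C∁ : C.rows ⊆∁ W
  C∁ i Ci = W₁∁ i (C.rows⊆ i Ci)

  B∩C-empty : ∀ k → B.rows k ≡ true → C.rows k ≡ true → ⊥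
  B∩C-empty k Bk Ck = true≢false (trans (sym (B.rows⊆ k Bk)) (C∁ k Ck))

  card-K : card K ≡ card B.rows + card C.rows
  card-K = card-∪-disjoint B.rows C.rows disjoint
    where
    disjoint : ∀ k → B.rows k ∧ C.rows k ≡ false
    disjoint k with B.rows k in Bk | C.rows k in Ck
    ... | false | _     = refl
    ... | true  | false = refl
    ... | true  | true  = ⊥-elim (B∩C-empty k Bk Ck)

  K⊆ : K ⊆ (W ∪ W₁)
  K⊆ k e = [ (λ Bk → ∪-introˡ W W₁ (B.rows⊆ k Bk)) ,
              (λ Ck → ∪-introʳ W W₁ (C.rows⊆ k Ck)) ]′ (∨-true e)

  -- A dependency T ⊆ K on W ∪ W₂ has its part off W orthogonal to the
  -- representatives of W₂, hence empty by independence of C in Γ_W(G); so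
  -- T ⊆ B, contradicting independence of B.
  K-independent : Independent A (W ∪ W₂) K
  K-independent (T , T⊆K , nonempty , vanishes) =
    B.independent (T , T⊆B , nonempty , λ j Wj → vanishes j (∪-introˡ W W₂ Wj))
    where
    TB TC : Subset n
    TB i = T i ∧ W i
    TC i = T i ∧ not (W i)

    T-split : T ≗ (TB +ᵥ TC)
    T-split i with T i | W i
    ... | false | _     = refl
    ... | true  | false = refl
    ... | true  | true  = refl

    TB∈W : TB ∈⟨ W ⟩
    TB∈W i e = ∧-conicalʳ (T i) _ e

    TC∁ : TC ⊆∁ W
    TC∁ i e with W i
    ... | false = refl
    ... | true  = ⊥-elim (true≢false (trans (sym e) (∧-zeroʳ (T i))))

    TC⊆C : TC ⊆ C.rows
    TC⊆C i e = [ (λ Bi → ⊥-elim (true≢false (trans (sym (B.rows⊆ i Bi)) (TC∁ i e)))) , (λ Ci → Ci) ]′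
                 (∨-true (T⊆K i (∧-conicalˡ _ _ e)))

    TC-orthogonal : ∀ j → W₂ j ≡ true → ℰ G TC (rep R j) ≡ false
    TC-orthogonal j W₂j = begin
      ℰ G TC (rep R j)
        ≡⟨ cong (_xor ℰ G TC (rep R j)) (sym (⊥-orthogonal (rep R j) TB (rep-⊥ R j (W₂∁ j W₂j)) TB∈W)) ⟩
      ℰ G TB (rep R j) xor ℰ G TC (rep R j)
        ≡⟨ sym (ℰ-xorˡ TB TC (rep R j)) ⟩
      ℰ G (TB +ᵥ TC) (rep R j)
        ≡⟨ sym (ℰ-congˡ (rep R j) T-split) ⟩
      ℰ G T (rep R j)
        ≡⟨ vanishes⇒orthogonal W₂∁ T vanishes j W₂j ⟩
      false ∎
      where open ≡-Reasoning

    TC-empty : ∀ i → TC i ≡ false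
    TC-empty with any₂ TC in some
    ... | false = any₂-none TC some
    ... | true  = ⊥-elim (C.independent (TC , TC⊆C , any₂-witness TC some ,
                    λ j W₂j → trans (Γ-comb TC j TC∁ (W₂∁ j W₂j)) (TC-orthogonal j W₂j)))

    T⊆B : T ⊆ B.rows
    T⊆B i Ti = [ (λ Bi → Bi) ,
                 (λ Ci → ⊥-elim (true≢false (trans (sym (inTC Ci)) (TC-empty i)))) ]′ (∨-true (T⊆K i Ti))
      where
      inTC : C.rows i ≡ true → TC i ≡ true
      inTC Ci = subst (λ b → T i ∧ not b ≡ true) (sym (C∁ i Ci)) (trans (∧-identityʳ (T i)) Ti)

  lower-bound : card B.rows + card C.rows ≤ rank A (W ∪ W₁) (W ∪ W₂)
  lower-bound = subst (_≤ rank A (W ∪ W₁) (W ∪ W₂)) card-K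
                      (rank-upper A (W ∪ W₁) (W ∪ W₂) K K⊆ K-independent)

  -- Rows of W: B spans them on W, and the vanishing combination F + e_i lies
  -- in ⟨W⟩, so by reducibility it vanishes on all columns.
  W-spanning : Spanning A W (λ _ → true) B.rows
  W-spanning = spanning A W-row-spans
    where
    W-row-spans : ∀ i → W i ≡ true → Spans A (λ _ → true) B.rows i
    W-row-spans i Wi with rowBasis-spans (rowBasis A W W) i Wi
    ... | F , F⊆B , agrees = F , F⊆B , λ j _ → vanishes⇒spans A F i j (radical (F +ᵥ basis i) z∈W onW j)
      where
      z∈W : (F +ᵥ basis i) ∈⟨ W ⟩
      z∈W = +ᵥ-⊆ (λ k Fk → B.rows⊆ k (F⊆B k Fk)) (basis-⊆ i Wi)
      onW : vanishesOn (comb A (F +ᵥ basis i)) W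
      onW j Wj = spans⇒vanishes A F i j (agrees j Wj)

  module BW = Spanning W-spanning

  B⊆K : B.rows ⊆ K
  B⊆K k Bk = ∪-introˡ B.rows C.rows Bk

  C⊆K : C.rows ⊆ K
  C⊆K k Ck = ∪-introʳ B.rows C.rows Ck

  -- Rows of W₁: C spans them in Γ_W(G) on W₂; splitting the vanishing
  -- combination T = F + e_i as a + b with a ∈ ⟨W⟩, b ∈ ⟨W⟩^⊥, the part b
  -- vanishes on W ∪ W₂ and the part a is spanned by B.
  W₁-spans : ∀ i → W₁ i ≡ true → Spans A (W ∪ W₂) K i
  W₁-spans i W₁i with rowBasis-spans (rowBasis ΓW W₁ W₂) i W₁i
  ... | F , F⊆C , agreesΓ with reducible (F +ᵥ basis i)
  ...   | a , b , a∈W , b⊥ , split = F +ᵥ lin a BW.coeffs , F'⊆K , agrees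
    where
    T : Subset n
    T = F +ᵥ basis i

    T∁ : T ⊆∁ W
    T∁ k e = [ (λ Fk → C∁ k (F⊆C k Fk)) ,
               (λ eik → subst (λ m → W m ≡ false) (basis-eq i k eik) (W₁∁ i W₁i)) ]′ (xor-true e)

    T-orthogonal : ∀ j → W₂ j ≡ true → ℰ G T (rep R j) ≡ false
    T-orthogonal j W₂j =
      trans (sym (Γ-comb T j T∁ (W₂∁ j W₂j))) (spans⇒vanishes ΓW F i j (agreesΓ j W₂j))

    b-split : b ≗ (T +ᵥ a)
    b-split k = begin
      b k                   ≡⟨ sym (xor-cancelˡ (a k) (b k)) ⟩
      a k xor (a k xor b k) ≡⟨ cong (a k xor_) (sym (split k)) ⟩
      a k xor T k           ≡⟨ xor-comm (a k) (T k) ⟩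
      T k xor a k           ∎
      where open ≡-Reasoning

    b-orthogonal : ∀ j → W₂ j ≡ true → ℰ G b (rep R j) ≡ false
    b-orthogonal j W₂j = begin
      ℰ G b (rep R j)
        ≡⟨ ℰ-congˡ (rep R j) b-split ⟩
      ℰ G (T +ᵥ a) (rep R j)
        ≡⟨ ℰ-xorˡ T a (rep R j) ⟩
      ℰ G T (rep R j) xor ℰ G a (rep R j)
        ≡⟨ cong₂ _xor_ (T-orthogonal j W₂j)
                       (⊥-orthogonal (rep R j) a (rep-⊥ R j (W₂∁ j W₂j)) a∈W) ⟩
      false ∎
      where open ≡-Reasoning

    b-vanishes : vanishesOn (comb A b) (W ∪ W₂)
    b-vanishes = orthogonal⇒vanishes W₂∁ b b-onW b-orthogonal
      where
      b-onW : vanishesOn (comb A b) W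
      b-onW k Wk = trans (sym (ℰ-basisʳ b k)) (b⊥ (basis k) (basis-⊆ k Wk))

    F'⊆K : (F +ᵥ lin a BW.coeffs) ⊆ K
    F'⊆K = +ᵥ-⊆ (λ k Fk → C⊆K k (F⊆C k Fk))
                (lin-⊆ a BW.coeffs K (λ m k e → B⊆K k (BW.coeffs⊆ m k e)))

    agrees : ∀ j → (W ∪ W₂) j ≡ true → A i j ≡ comb A (F +ᵥ lin a BW.coeffs) j
    agrees j e = begin
      A i j
        ≡⟨ sym (xor-cancelˡ (comb A F j) (A i j)) ⟩
      comb A F j xor (comb A F j xor A i j)
        ≡⟨ cong (comb A F j xor_) (sym (comb-addRow A F i j)) ⟩
      comb A F j xor comb A T j
        ≡⟨ cong (comb A F j xor_) (trans (comb-cong A split j) (comb-xor A a b j)) ⟩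
      comb A F j xor (comb A a j xor comb A b j)
        ≡⟨ cong (λ c → comb A F j xor (comb A a j xor c)) (b-vanishes j e) ⟩
      comb A F j xor (comb A a j xor false)
        ≡⟨ cong (comb A F j xor_) (xor-identityʳ (comb A a j)) ⟩
      comb A F j xor comb A a j
        ≡⟨ cong (comb A F j xor_) (sym (spanning-lin A W-spanning a a∈W j refl)) ⟩
      comb A F j xor comb A (lin a BW.coeffs) j
        ≡⟨ sym (comb-xor A F (lin a BW.coeffs) j) ⟩
      comb A (F +ᵥ lin a BW.coeffs) j ∎
      where open ≡-Reasoning

  K-spanning : Spanning A (W ∪ W₁) (W ∪ W₂) K
  K-spanning = spanning A row-spans
    where
    row-spans : ∀ i → (W ∪ W₁) i ≡ true → Spans A (W ∪ W₂) K i
    row-spans i e with ∨-true e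
    ... | inj₁ Wi  = BW.coeffs i , (λ k ck → B⊆K k (BW.coeffs⊆ i k ck)) , λ j _ → BW.spans i Wi j refl
    ... | inj₂ W₁i = W₁-spans i W₁i

  upper-bound : rank A (W ∪ W₁) (W ∪ W₂) ≤ card B.rows + card C.rows
  upper-bound = subst (rank A (W ∪ W₁) (W ∪ W₂) ≤_) card-K
                      (rank-≤-spanning A (W ∪ W₁) (W ∪ W₂) K K-spanning)

mainTheorem5 : (n : ℕ) (G : Graph n) (W : Subset n) → Reducible G W →
    (R : Representatives G W) (W₁ W₂ : Subset n) → W₁ ⊆∁ W → W₂ ⊆∁ W →
    rank (Γ G W R) W₁ W₂ ≡ rankG G (W ∪ W₁) (W ∪ W₂) ∸ rankG G W W
mainTheorem5 n G W reducible R W₁ W₂ W₁∁ W₂∁ = begin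
  rank (Γ G W R) W₁ W₂
    ≡⟨ sym C.card≡rank ⟩
  card C.rows
    ≡⟨ sym (m+n∸m≡n (card B.rows) (card C.rows)) ⟩
  (card B.rows + card C.rows) ∸ card B.rows
    ≡⟨ cong₂ _∸_ (≤-antisym lower-bound upper-bound) B.card≡rank ⟩
  rankG G (W ∪ W₁) (W ∪ W₂) ∸ rankG G W W ∎
  where
  open ≡-Reasoning
  open RankFormula G W reducible R W₁∁ W₂∁
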